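{- Let $A,B,C,D\subset\mathbb{R}^d$ be pairwise disjoint finite nonempty sets with $|A|\le|B|$ and $|C|\ge|D|$. Then $\Delta(A\cup B\cup C\cup D)\le\Delta(A)+3\Delta(B\cup C)+\Delta(D)+4D(A,B)+4D(C,D)$ and $D(A\cup B,C\cup D)\le 3\Delta(B\cup C)+3D(A,B)+3D(C,D)-\Delta(B)-\Delta(C)$.
   Context: For finite nonempty $Q\subset\mathbb{R}^d$, $\mu(Q)$ is the centroid, $\Delta(Q)=\sum_{q\in Q}\|q-\mu(Q)\|^2$, and for disjoint $X,Y$, $D(X,Y)=\Delta(X\cup Y)-\Delta(X)-\Delta(Y)$. -}

module Defs where

open import Level using (_⊔_) renaming (suc to lsuc)
open import Data.Nat using (ℕ; zero; suc)
open import Data.Fin using (Fin)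
open import Data.List using (List; []; _∷_; _++_; length; foldr; map)
open import Data.List.Relation.Unary.All using (All)
open import Data.List.Relation.Unary.AllPairs using (AllPairs)
open import Relation.Binary.Core using (Rel)
open import Relation.Binary.Structures using (IsTotalOrder)
open import Relation.Nullary using (¬_)
open import Algebra.Bundles using (CommutativeRing)

-- An ordered field (the reals ℝ are one; agda-stdlib has no reals, so we
-- state the result for every ordered field, which covers ℝ^d).
-- The inverse is total (as in Lean/Mathlib); it is only specified on nonzero elements.
record OrderedField c ℓ₁ ℓ₂ : Set (lsuc (c ⊔ ℓ₁ ⊔ ℓ₂)) where
  field
    commutativeRing : CommutativeRing c ℓ₁
  open CommutativeRing commutativeRing public
  infix 4 _≤_
  field
    _≤_          : Rel Carrier ℓ₂
    isTotalOrder : IsTotalOrder _≈_ _≤_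
    +-monoˡ-≤    : ∀ {x y} z → x ≤ y → x + z ≤ y + z
    *-nonneg     : ∀ {x y} → 0# ≤ x → 0# ≤ y → 0# ≤ x * y
    0≉1          : ¬ (0# ≈ 1#)
    _⁻¹          : Carrier → Carrier
    ⁻¹-inverse   : ∀ {x} → ¬ (x ≈ 0#) → x * (x ⁻¹) ≈ 1#

module _ {c ℓ₁ ℓ₂} (F : OrderedField c ℓ₁ ℓ₂) where
  open OrderedField F

  Point : ℕ → Set c
  Point d = Fin d → Carrier

  _≈ₚ_ : ∀ {d} → Point d → Point d → Set ℓ₁
  p ≈ₚ q = ∀ i → p i ≈ q i

  -- a finite set of points, given as a duplicate-free list
  IsFinSet : ∀ {d} → List (Point d) → Set (c ⊔ ℓ₁)
  IsFinSet = AllPairs (λ p q → ¬ (p ≈ₚ q))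

  NonEmpty : ∀ {d} → List (Point d) → Set
  NonEmpty [] = Data.Empty.⊥ where import Data.Empty
  NonEmpty (_ ∷ _) = Data.Unit.⊤ where import Data.Unit

  Disjoint : ∀ {d} → List (Point d) → List (Point d) → Set (c ⊔ ℓ₁)
  Disjoint X Y = All (λ x → All (λ y → ¬ (x ≈ₚ y)) Y) X

  sumFin : ∀ n → (Fin n → Carrier) → Carrier
  sumFin zero    f = 0#
  sumFin (suc n) f = f Fin.zero + sumFin n (λ i → f (Fin.suc i))
    where import Data.Fin as Fin

  sumList : List Carrier → Carrier
  sumList = foldr _+_ 0#

  fromℕ : ℕ → Carrier
  fromℕ zero    = 0#
  fromℕ (suc n) = 1# + fromℕ n

  _+ₚ_ : ∀ {d} → Point d → Point d → Point d
  (p +ₚ q) i = p i + q i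

  _-ₚ_ : ∀ {d} → Point d → Point d → Point d
  (p -ₚ q) i = p i - q i

  zeroₚ : ∀ {d} → Point d
  zeroₚ i = 0#

  ‖_‖² : ∀ {d} → Point d → Carrier
  ‖_‖² {d} p = sumFin d (λ i → p i * p i)

  μ : ∀ {d} → List (Point d) → Point d
  μ Q i = (fromℕ (length Q)) ⁻¹ * sumList (map (λ q → q i) Q)

  Δ : ∀ {d} → List (Point d) → Carrier
  Δ Q = sumList (map (λ q → ‖ q -ₚ μ Q ‖²) Q)

  -- D(X,Y) = Δ(X ∪ Y) − Δ(X) − Δ(Y)  (X, Y disjoint, so X ∪ Y is X ++ Y)
  Dist : ∀ {d} → List (Point d) → List (Point d) → Carrier
  Dist X Y = Δ (X ++ Y) - Δ X - Δ Y

module Submission where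

-- Δ and D are sums over the coordinates of their one-dimensional versions, so it is
-- enough to show D(A∪B, C∪D) ≤ 3 (D(A,B) + D(B,C) + D(C,D)) on the line: both
-- inequalities are rearrangements of this bound and of Δ(B), Δ(C) ≥ 0.
-- On the line the parallel axis theorem gives D(X,Y) ≤ |X| (μX − c)² + |Y| (μY − c)²
-- for every c, with equality at c = μ(X∪Y).  Take c = μ(B∪C).  As |A| ≤ |B|, the
-- centroid of A∪B lies near that of B, |A∪B| (μ(A∪B) − μB)² ≤ D(A,B), hence
-- |A∪B| (μ(A∪B) − c)² ≤ 3 D(A,B) + 3 |B| (μB − c)²; symmetrically for C∪D, and the
-- two leftover terms |B| (μB − c)² + |C| (μC − c)² add up to D(B,C).

open import Defs
open import Level using (0ℓ)
open import Data.Nat as ℕ using (ℕ; zero; suc) renaming (_≤_ to _≤ℕ_)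
open import Data.Product using (_×_; _,_)
open import Data.Sum using (inj₁; inj₂)
open import Data.Maybe using (Maybe; just; nothing)
open import Relation.Nullary using (yes; no; ¬_; contradiction)
open import Relation.Binary.PropositionalEquality as ≡ using (_≡_; _≢_)
open import Algebra.Bundles using (RawRing)
open import Relation.Binary.Bundles using (Poset)
open import Relation.Binary.Structures using (IsTotalOrder)
import Algebra.Solver.Ring.AlmostCommutativeRing as ACR
import Relation.Binary.Reasoning.Setoid
import Relation.Binary.Reasoning.PartialOrder
open import Data.List using (List; []; _∷_; _++_; length; map)
open import Data.Fin as Fin using (Fin)
open import Function using (_∘_)
import Data.List.Properties as List

-- The solver of Algebra.Solver.Ring closes an equation by `refl` on normal
-- forms, so coefficients must have canonical representatives: here an
-- integer p − q is the pair (p , q) with one component zero.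
module IntegerCoefficientSolver {ℓ ℓ₁ ℓ₂} (F : OrderedField ℓ ℓ₁ ℓ₂) where
  open OrderedField F
  open Relation.Binary.Reasoning.Setoid setoid
  open import Algebra.Properties.Semiring.Mult semiring using (×-homo-+; ×1-homo-*) renaming (_×_ to _×ₙ_)
  open import Algebra.Properties.Ring ring using (-‿distribˡ-*; -‿distribʳ-*)
  open import Algebra.Properties.AbelianGroup +-abelianGroup using (⁻¹-∙-comm; ⁻¹-anti-homo‿-)
  open import Algebra.Properties.Group +-group using (⁻¹-involutive; ε⁻¹≈ε)
  open import Algebra.Properties.CommutativeSemigroup +-commutativeSemigroup using (interchange)

  private
    fromℕ≡×ₙ1# : ∀ n → fromℕ F n ≡ n ×ₙ 1#
    fromℕ≡×ₙ1# zero    = ≡.refl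
    fromℕ≡×ₙ1# (suc n) = ≡.cong (1# +_) (fromℕ≡×ₙ1# n)

  fromℕ-+ : ∀ m n → fromℕ F (m ℕ.+ n) ≈ fromℕ F m + fromℕ F n
  fromℕ-+ m n rewrite fromℕ≡×ₙ1# (m ℕ.+ n) | fromℕ≡×ₙ1# m | fromℕ≡×ₙ1# n = ×-homo-+ 1# m n

  fromℕ-* : ∀ m n → fromℕ F (m ℕ.* n) ≈ fromℕ F m * fromℕ F n
  fromℕ-* m n rewrite fromℕ≡×ₙ1# (m ℕ.* n) | fromℕ≡×ₙ1# m | fromℕ≡×ₙ1# n = ×1-homo-* m n

  private
    [a-b]+[c-d]≈[a+c]-[b+d] : ∀ a b c d → (a - b) + (c - d) ≈ (a + c) - (b + d)
    [a-b]+[c-d]≈[a+c]-[b+d] a b c d = trans (interchange a (- b) c (- d)) (+-congˡ (⁻¹-∙-comm b d))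

    [a-b]*[c-d]≈[ac+bd]-[ad+bc] : ∀ a b c d → (a - b) * (c - d) ≈ (a * c + b * d) - (a * d + b * c)
    [a-b]*[c-d]≈[ac+bd]-[ad+bc] a b c d = begin
      (a - b) * (c - d)                       ≈⟨ distribʳ (c - d) a (- b) ⟩
      a * (c - d) + - b * (c - d)             ≈⟨ +-cong (distribˡ a c (- d)) (distribˡ (- b) c (- d)) ⟩
      (a * c + a * - d) + (- b * c + - b * - d)
        ≈⟨ +-cong (+-congˡ (sym (-‿distribʳ-* a d)))
                  (+-cong (sym (-‿distribˡ-* b c)) (trans (sym (-‿distribˡ-* b (- d))) (trans (-‿cong (sym (-‿distribʳ-* b d))) (⁻¹-involutive _)))) ⟩
      (a * c - a * d) + (- (b * c) + b * d)   ≈⟨ +-congˡ (+-comm _ _) ⟩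
      (a * c - a * d) + (b * d - b * c)       ≈⟨ [a-b]+[c-d]≈[a+c]-[b+d] (a * c) (a * d) (b * d) (b * c) ⟩
      (a * c + b * d) - (a * d + b * c)       ∎

    a+d≈c+b⇒a-b≈c-d : ∀ {a b c d} → a + d ≈ c + b → a - b ≈ c - d
    a+d≈c+b⇒a-b≈c-d {a} {b} {c} {d} eq = begin
      a - b                 ≈⟨ sym (+-identityʳ _) ⟩
      (a - b) + 0#          ≈⟨ +-congˡ (sym (-‿inverseʳ d)) ⟩
      (a - b) + (d - d)     ≈⟨ [a-b]+[c-d]≈[a+c]-[b+d] a b d d ⟩
      (a + d) - (b + d)     ≈⟨ +-cong eq (-‿cong (+-comm b d)) ⟩
      (c + b) - (d + b)     ≈⟨ [a-b]+[c-d]≈[a+c]-[b+d] c d b b ⟨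
      (c - d) + (b - b)     ≈⟨ +-congˡ (-‿inverseʳ b) ⟩
      (c - d) + 0#          ≈⟨ +-identityʳ _ ⟩
      c - d                 ∎

    Pair : Set
    Pair = ℕ × ℕ

    canonical : Pair → Pair
    canonical (p , q) = p ℕ.∸ q , q ℕ.∸ p

    Coefficients : RawRing 0ℓ 0ℓ
    Coefficients = record
      { Carrier = Pair
      ; _≈_     = _≡_
      ; _+_     = λ { (p , q) (r , s) → canonical (p ℕ.+ r , q ℕ.+ s) }
      ; _*_     = λ { (p , q) (r , s) → canonical (p ℕ.* r ℕ.+ q ℕ.* s , p ℕ.* s ℕ.+ q ℕ.* r) }
      ; -_      = λ { (p , q) → q , p }
      ; 0#      = 0 , 0
      ; 1#      = 1 , 0
      }

    module C = RawRing Coefficients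

    -- Natural constants are interpreted as `fromℕ F n` on the nose, so that
    -- `con (n , 0)` matches the numerals of the statements.
    ⟦_⟧ : Pair → Carrier
    ⟦ p , zero  ⟧ = fromℕ F p
    ⟦ p , suc q ⟧ = fromℕ F p - fromℕ F (suc q)

    ⟦p,q⟧≈p-q : ∀ p q → ⟦ p , q ⟧ ≈ fromℕ F p - fromℕ F q
    ⟦p,q⟧≈p-q p zero    = sym (trans (+-congˡ ε⁻¹≈ε) (+-identityʳ _))
    ⟦p,q⟧≈p-q p (suc q) = refl

    canonical-sound : ∀ p q → fromℕ F (p ℕ.∸ q) - fromℕ F (q ℕ.∸ p) ≈ fromℕ F p - fromℕ F q
    canonical-sound zero    zero    = refl
    canonical-sound (suc p) zero    = refl
    canonical-sound zero    (suc q) = refl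
    canonical-sound (suc p) (suc q) = begin
      fromℕ F (p ℕ.∸ q) - fromℕ F (q ℕ.∸ p)   ≈⟨ canonical-sound p q ⟩
      fromℕ F p - fromℕ F q                   ≈⟨ +-identityˡ _ ⟨
      0# + (fromℕ F p - fromℕ F q)            ≈⟨ +-congʳ (-‿inverseʳ 1#) ⟨
      (1# - 1#) + (fromℕ F p - fromℕ F q)     ≈⟨ [a-b]+[c-d]≈[a+c]-[b+d] 1# 1# _ _ ⟩
      fromℕ F (suc p) - fromℕ F (suc q)       ∎

    ⟦canonical⟧ : ∀ p q → ⟦ canonical (p , q) ⟧ ≈ fromℕ F p - fromℕ F q
    ⟦canonical⟧ p q = trans (⟦p,q⟧≈p-q (p ℕ.∸ q) (q ℕ.∸ p)) (canonical-sound p q)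

    ⟦⟧-+-homo : ∀ x y → ⟦ x C.+ y ⟧ ≈ ⟦ x ⟧ + ⟦ y ⟧
    ⟦⟧-+-homo (p , q) (r , s) = begin
      ⟦ canonical (p ℕ.+ r , q ℕ.+ s) ⟧                    ≈⟨ ⟦canonical⟧ (p ℕ.+ r) (q ℕ.+ s) ⟩
      fromℕ F (p ℕ.+ r) - fromℕ F (q ℕ.+ s)                ≈⟨ +-cong (fromℕ-+ p r) (-‿cong (fromℕ-+ q s)) ⟩
      (fromℕ F p + fromℕ F r) - (fromℕ F q + fromℕ F s)    ≈⟨ [a-b]+[c-d]≈[a+c]-[b+d] _ _ _ _ ⟨
      (fromℕ F p - fromℕ F q) + (fromℕ F r - fromℕ F s)    ≈⟨ +-cong (⟦p,q⟧≈p-q p q) (⟦p,q⟧≈p-q r s) ⟨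
      ⟦ p , q ⟧ + ⟦ r , s ⟧                                ∎

    ⟦⟧-*-homo : ∀ x y → ⟦ x C.* y ⟧ ≈ ⟦ x ⟧ * ⟦ y ⟧
    ⟦⟧-*-homo (p , q) (r , s) = begin
      ⟦ canonical (p ℕ.* r ℕ.+ q ℕ.* s , p ℕ.* s ℕ.+ q ℕ.* r) ⟧
        ≈⟨ ⟦canonical⟧ (p ℕ.* r ℕ.+ q ℕ.* s) (p ℕ.* s ℕ.+ q ℕ.* r) ⟩
      fromℕ F (p ℕ.* r ℕ.+ q ℕ.* s) - fromℕ F (p ℕ.* s ℕ.+ q ℕ.* r)
        ≈⟨ +-cong (trans (fromℕ-+ (p ℕ.* r) (q ℕ.* s)) (+-cong (fromℕ-* p r) (fromℕ-* q s)))
                  (-‿cong (trans (fromℕ-+ (p ℕ.* s) (q ℕ.* r)) (+-cong (fromℕ-* p s) (fromℕ-* q r)))) ⟩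
      (fromℕ F p * fromℕ F r + fromℕ F q * fromℕ F s) - (fromℕ F p * fromℕ F s + fromℕ F q * fromℕ F r)
        ≈⟨ [a-b]*[c-d]≈[ac+bd]-[ad+bc] _ _ _ _ ⟨
      (fromℕ F p - fromℕ F q) * (fromℕ F r - fromℕ F s)
        ≈⟨ *-cong (⟦p,q⟧≈p-q p q) (⟦p,q⟧≈p-q r s) ⟨
      ⟦ p , q ⟧ * ⟦ r , s ⟧ ∎

    ⟦⟧-‿homo : ∀ x → ⟦ C.- x ⟧ ≈ - ⟦ x ⟧
    ⟦⟧-‿homo (p , q) = begin
      ⟦ q , p ⟧                  ≈⟨ ⟦p,q⟧≈p-q q p ⟩
      fromℕ F q - fromℕ F p      ≈⟨ ⁻¹-anti-homo‿- _ _ ⟨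
      - (fromℕ F p - fromℕ F q)  ≈⟨ -‿cong (⟦p,q⟧≈p-q p q) ⟨
      - ⟦ p , q ⟧                ∎

    morphism : Coefficients ACR.-Raw-AlmostCommutative⟶ ACR.fromCommutativeRing commutativeRing
    morphism = record
      { ⟦_⟧    = ⟦_⟧
      ; +-homo = ⟦⟧-+-homo
      ; *-homo = ⟦⟧-*-homo
      ; -‿homo = ⟦⟧-‿homo
      ; 0-homo = refl
      ; 1-homo = +-identityʳ 1#
      }

    ⟦⟧-≈? : ∀ x y → Maybe (⟦ x ⟧ ≈ ⟦ y ⟧)
    ⟦⟧-≈? (p , q) (r , s) with p ℕ.+ s ℕ.≟ r ℕ.+ q
    ... | no  _  = nothing
    ... | yes eq = just (begin
      ⟦ p , q ⟧              ≈⟨ ⟦p,q⟧≈p-q p q ⟩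
      fromℕ F p - fromℕ F q  ≈⟨ a+d≈c+b⇒a-b≈c-d (trans (sym (fromℕ-+ p s)) (trans (reflexive (≡.cong (fromℕ F) eq)) (fromℕ-+ r q))) ⟩
      fromℕ F r - fromℕ F s  ≈⟨ ⟦p,q⟧≈p-q r s ⟨
      ⟦ r , s ⟧              ∎)

  open import Algebra.Solver.Ring Coefficients (ACR.fromCommutativeRing commutativeRing) morphism ⟦⟧-≈?
    public using (solve; _:=_; con; _:+_; _:-_; _:*_)

module OrderedFieldProperties {ℓ ℓ₁ ℓ₂} (F : OrderedField ℓ ℓ₁ ℓ₂) where
  open OrderedField F
  open IntegerCoefficientSolver F
  open IsTotalOrder isTotalOrder public
    using (total; antisym; ≤-respˡ-≈; ≤-respʳ-≈) renaming (reflexive to ≤-reflexive; refl to ≤-refl; trans to ≤-trans)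

  infixl 8 _²
  _² : Carrier → Carrier
  x ² = x * x

  poset : Poset ℓ ℓ₁ ℓ₂
  poset = record { isPartialOrder = IsTotalOrder.isPartialOrder isTotalOrder }

  module ≈-Reasoning = Relation.Binary.Reasoning.Setoid setoid
  module ≤-Reasoning = Relation.Binary.Reasoning.PartialOrder poset

  r≈0⇒x+r*y≈x : ∀ {r} x y → r ≈ 0# → x + r * y ≈ x
  r≈0⇒x+r*y≈x x y r≈0 = trans (+-congˡ (trans (*-congʳ r≈0) (zeroˡ y))) (+-identityʳ x)

  x≤y⇒0≤y-x : ∀ {x y} → x ≤ y → 0# ≤ y - x
  x≤y⇒0≤y-x {x} h = ≤-respˡ-≈ (-‿inverseʳ x) (+-monoˡ-≤ (- x) h)

  0≤y-x⇒x≤y : ∀ {x y} → 0# ≤ y - x → x ≤ y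
  0≤y-x⇒x≤y {x} {y} h =
    ≤-respˡ-≈ (+-identityˡ x) (≤-respʳ-≈ (solve 2 (λ y x → y :- x :+ x := y) refl y x) (+-monoˡ-≤ x h))

  ≤-by-difference : ∀ {x y z} → y - x ≈ z → 0# ≤ z → x ≤ y
  ≤-by-difference eq 0≤z = 0≤y-x⇒x≤y (≤-respʳ-≈ (sym eq) 0≤z)

  +-mono-≤ : ∀ {x y u v} → x ≤ y → u ≤ v → x + u ≤ y + v
  +-mono-≤ {x} {y} {u} {v} x≤y u≤v =
    ≤-trans (+-monoˡ-≤ u x≤y) (≤-respˡ-≈ (+-comm u y) (≤-respʳ-≈ (+-comm v y) (+-monoˡ-≤ y u≤v)))

  +-nonNeg : ∀ {x y} → 0# ≤ x → 0# ≤ y → 0# ≤ x + y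
  +-nonNeg 0≤x 0≤y = ≤-respˡ-≈ (+-identityʳ 0#) (+-mono-≤ 0≤x 0≤y)

  0≤x² : ∀ x → 0# ≤ x ²
  0≤x² x with total 0# x
  ... | inj₁ 0≤x = *-nonneg 0≤x 0≤x
  ... | inj₂ x≤0 = ≤-respʳ-≈ (solve 1 (λ x → (con (0 , 0) :- x) :* (con (0 , 0) :- x) := x :* x) refl x)
                             (*-nonneg (x≤y⇒0≤y-x x≤0) (x≤y⇒0≤y-x x≤0))

  0≤1 : 0# ≤ 1#
  0≤1 = ≤-respʳ-≈ (*-identityˡ 1#) (0≤x² 1#)

  0≤fromℕ : ∀ n → 0# ≤ fromℕ F n
  0≤fromℕ zero    = ≤-refl
  0≤fromℕ (suc n) = +-nonNeg 0≤1 (0≤fromℕ n)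

  fromℕ-mono-≤ : ∀ {m n} → m ≤ℕ n → fromℕ F m ≤ fromℕ F n
  fromℕ-mono-≤ {n = n} ℕ.z≤n = 0≤fromℕ n
  fromℕ-mono-≤ (ℕ.s≤s m≤n) = ≤-respˡ-≈ (+-comm _ 1#) (≤-respʳ-≈ (+-comm _ 1#) (+-monoˡ-≤ 1# (fromℕ-mono-≤ m≤n)))

  fromℕ-suc≉0 : ∀ n → ¬ fromℕ F (suc n) ≈ 0#
  fromℕ-suc≉0 n eq = 0≉1 (antisym 0≤1 (≤-respʳ-≈ eq 1≤fromℕ-suc))
    where
    1≤fromℕ-suc : 1# ≤ fromℕ F (suc n)
    1≤fromℕ-suc = ≤-respˡ-≈ (+-identityʳ 1#) (≤-respˡ-≈ (+-comm 0# 1#) (≤-respʳ-≈ (+-comm _ 1#) (+-monoˡ-≤ 1# (0≤fromℕ n))))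

  *-cancelˡ-nonNeg : ∀ {a x} → 0# ≤ a → ¬ a ≈ 0# → 0# ≤ a * x → 0# ≤ x
  *-cancelˡ-nonNeg {a} {x} 0≤a a≉0 0≤ax with total 0# x
  ... | inj₁ 0≤x = 0≤x
  ... | inj₂ x≤0 = ≤-reflexive (sym x≈0)
    where
    ax≤0 : a * x ≤ 0#
    ax≤0 = ≤-by-difference (solve 2 (λ a x → con (0 , 0) :- a :* x := a :* (con (0 , 0) :- x)) refl a x)
                          (*-nonneg 0≤a (x≤y⇒0≤y-x x≤0))
    x≈0 : x ≈ 0#
    x≈0 = begin
      x                ≈⟨ *-identityˡ x ⟨
      1# * x           ≈⟨ *-congʳ (trans (*-comm (a ⁻¹) a) (⁻¹-inverse a≉0)) ⟨
      (a ⁻¹ * a) * x   ≈⟨ *-assoc _ a x ⟩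
      a ⁻¹ * (a * x)   ≈⟨ *-congˡ (antisym ax≤0 0≤ax) ⟩
      a ⁻¹ * 0#        ≈⟨ zeroʳ _ ⟩
      0#               ∎
      where open ≈-Reasoning

module TwoMasses {ℓ ℓ₁ ℓ₂} (F : OrderedField ℓ ℓ₁ ℓ₂) where
  open OrderedField F
  open IntegerCoefficientSolver F
  open OrderedFieldProperties F

  heavier-near-centre : ∀ {a b x y p} → 0# ≤ a → ¬ a ≈ 0# → a ≤ b → (a + b) * p ≈ a * x + b * y →
                        (a + b) * (y - p) ² ≤ a * (x - p) ² + b * (y - p) ²
  heavier-near-centre {a} {b} {x} {y} {p} 0≤a a≉0 a≤b centre =
    0≤y-x⇒x≤y (*-cancelˡ-nonNeg 0≤a a≉0 (≤-respʳ-≈ (sym a*gap≈) 0≤[b-a][b+a][y-p]²))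
    where
    0≤[b-a][b+a][y-p]² : 0# ≤ (b - a) * (b + a) * (y - p) ²
    0≤[b-a][b+a][y-p]² =
      *-nonneg (*-nonneg (x≤y⇒0≤y-x a≤b) (+-nonNeg (≤-trans 0≤a a≤b) 0≤a)) (0≤x² (y - p))
    -- a (x − p) = b (p − y) turns a² (x − p)² into b² (y − p)².
    a*gap≈ : a * (a * (x - p) ² + b * (y - p) ² - (a + b) * (y - p) ²) ≈ (b - a) * (b + a) * (y - p) ²
    a*gap≈ = trans
      (solve 5 (λ a b x y p →
          a :* (a :* ((x :- p) :* (x :- p)) :+ b :* ((y :- p) :* (y :- p)) :- (a :+ b) :* ((y :- p) :* (y :- p)))
       := (b :- a) :* (b :+ a) :* ((y :- p) :* (y :- p))
          :+ (a :* x :+ b :* y :- (a :+ b) :* p) :* (a :* (x :- p) :+ b :* (p :- y))) refl a b x y p)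
      (r≈0⇒x+r*y≈x _ _ (trans (+-congˡ (-‿cong centre)) (-‿inverseʳ _)))

  centre-deviation-bound : ∀ {a b x y p} → 0# ≤ a → ¬ a ≈ 0# → a ≤ b → (a + b) * p ≈ a * x + b * y →
    ∀ q → (a + b) * (p - q) ² ≤ fromℕ F 3 * (a * (x - p) ² + b * (y - p) ²) + fromℕ F 3 * (b * (y - q) ²)
  centre-deviation-bound {a} {b} {x} {y} {p} 0≤a a≉0 a≤b centre q =
    0≤y-x⇒x≤y (*-cancelˡ-nonNeg (0≤fromℕ 2) (fromℕ-suc≉0 1) (≤-respʳ-≈ (sym 2*gap≈) 0≤sum))
    where
    E : Carrier
    E = a * (x - p) ² + b * (y - p) ²
    0≤sum : 0# ≤ fromℕ F 6 * (E - (a + b) * (y - p) ²) + fromℕ F 3 * ((b - a) * (y - q) ²)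
                 + (a + b) * (fromℕ F 2 * (p - y) - (y - q)) ²
    0≤sum = +-nonNeg
      (+-nonNeg (*-nonneg (0≤fromℕ 6) (x≤y⇒0≤y-x (heavier-near-centre 0≤a a≉0 a≤b centre)))
                (*-nonneg (0≤fromℕ 3) (*-nonneg (x≤y⇒0≤y-x a≤b) (0≤x² (y - q)))))
      (*-nonneg (+-nonNeg 0≤a (≤-trans 0≤a a≤b)) (0≤x² _))
    -- (p − q)² = ((p − y) + (y − q))², then complete the square in p − y.
    2*gap≈ : fromℕ F 2 * (fromℕ F 3 * E + fromℕ F 3 * (b * (y - q) ²) - (a + b) * (p - q) ²)
           ≈ fromℕ F 6 * (E - (a + b) * (y - p) ²) + fromℕ F 3 * ((b - a) * (y - q) ²)
             + (a + b) * (fromℕ F 2 * (p - y) - (y - q)) ²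
    2*gap≈ = solve 6 (λ E a b y p q →
        con (2 , 0) :* (con (3 , 0) :* E :+ con (3 , 0) :* (b :* ((y :- q) :* (y :- q))) :- (a :+ b) :* ((p :- q) :* (p :- q)))
     := con (6 , 0) :* (E :- (a :+ b) :* ((y :- p) :* (y :- p))) :+ con (3 , 0) :* ((b :- a) :* ((y :- q) :* (y :- q)))
        :+ (a :+ b) :* ((con (2 , 0) :* (p :- y) :- (y :- q)) :* (con (2 , 0) :* (p :- y) :- (y :- q)))) refl E a b y p q

module Scatter {ℓ ℓ₁ ℓ₂} (F : OrderedField ℓ ℓ₁ ℓ₂) where
  open OrderedField F
  open IntegerCoefficientSolver F
  open OrderedFieldProperties F
  open TwoMasses F

  size : List Carrier → Carrier
  size xs = fromℕ F (length xs)

  mean : List Carrier → Carrier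
  mean xs = size xs ⁻¹ * sumList F xs

  ssd : List Carrier → Carrier → Carrier
  ssd xs c = sumList F (map (λ x → (x - c) ²) xs)

  Δ₁ : List Carrier → Carrier
  Δ₁ xs = ssd xs (mean xs)

  moment : List Carrier → Carrier → Carrier
  moment xs c = size xs * (mean xs - c) ²

  D₁ : List Carrier → List Carrier → Carrier
  D₁ xs ys = Δ₁ (xs ++ ys) - Δ₁ xs - Δ₁ ys

  sumList-++ : ∀ xs ys → sumList F (xs ++ ys) ≈ sumList F xs + sumList F ys
  sumList-++ []       ys = sym (+-identityˡ _)
  sumList-++ (x ∷ xs) ys = trans (+-congˡ (sumList-++ xs ys)) (sym (+-assoc x _ _))

  ssd-++ : ∀ xs ys c → ssd (xs ++ ys) c ≈ ssd xs c + ssd ys c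
  ssd-++ xs ys c = trans (reflexive (≡.cong (sumList F) (List.map-++ (λ x → (x - c) ²) xs ys)))
                         (sumList-++ (map (λ x → (x - c) ²) xs) _)

  size-++ : ∀ xs ys → size (xs ++ ys) ≈ size xs + size ys
  size-++ xs ys = trans (reflexive (≡.cong (fromℕ F) (List.length-++ xs))) (fromℕ-+ (length xs) (length ys))

  size≉0 : ∀ {xs} → xs ≢ [] → ¬ size xs ≈ 0#
  size≉0 {[]}     xs≢[] = contradiction ≡.refl xs≢[]
  size≉0 {x ∷ xs} _     = fromℕ-suc≉0 (length xs)

  -- Also for xs = [], where both sides are 0 whatever 0# ⁻¹ is.
  size*mean≈sum : ∀ xs → size xs * mean xs ≈ sumList F xs
  size*mean≈sum []       = zeroˡ _
  size*mean≈sum (x ∷ xs) = begin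
    size (x ∷ xs) * (size (x ∷ xs) ⁻¹ * sumList F (x ∷ xs))  ≈⟨ *-assoc _ _ _ ⟨
    (size (x ∷ xs) * size (x ∷ xs) ⁻¹) * sumList F (x ∷ xs)  ≈⟨ *-congʳ (⁻¹-inverse (fromℕ-suc≉0 (length xs))) ⟩
    1# * sumList F (x ∷ xs)                                  ≈⟨ *-identityˡ _ ⟩
    sumList F (x ∷ xs)                                       ∎
    where open ≈-Reasoning

  mean-++ : ∀ xs ys → (size xs + size ys) * mean (xs ++ ys) ≈ size xs * mean xs + size ys * mean ys
  mean-++ xs ys = begin
    (size xs + size ys) * mean (xs ++ ys)   ≈⟨ *-congʳ (size-++ xs ys) ⟨
    size (xs ++ ys) * mean (xs ++ ys)       ≈⟨ size*mean≈sum (xs ++ ys) ⟩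
    sumList F (xs ++ ys)                    ≈⟨ sumList-++ xs ys ⟩
    sumList F xs + sumList F ys             ≈⟨ +-cong (size*mean≈sum xs) (size*mean≈sum ys) ⟨
    size xs * mean xs + size ys * mean ys   ∎
    where open ≈-Reasoning

  ssd-expand : ∀ xs c → ssd xs c ≈ sumList F (map _² xs) - (c + c) * sumList F xs + size xs * c ²
  ssd-expand []       c =
    solve 1 (λ c → con (0 , 0) := con (0 , 0) :- (c :+ c) :* con (0 , 0) :+ con (0 , 0) :* (c :* c)) refl c
  ssd-expand (x ∷ xs) c = begin
    (x - c) ² + ssd xs c                                            ≈⟨ +-congˡ (ssd-expand xs c) ⟩
    (x - c) ² + (Q - (c + c) * s + n * c ²)
      ≈⟨ solve 5 (λ x c Q s n → (x :- c) :* (x :- c) :+ (Q :- (c :+ c) :* s :+ n :* (c :* c))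
                             := (x :* x :+ Q) :- (c :+ c) :* (x :+ s) :+ (con (1 , 0) :+ n) :* (c :* c))
                 refl x c Q s n ⟩
    (x ² + Q) - (c + c) * (x + s) + ((1# + 0#) + n) * c ²           ≈⟨ +-congˡ (*-congʳ (+-congʳ (+-identityʳ 1#))) ⟩
    (x ² + Q) - (c + c) * (x + s) + (1# + n) * c ²                  ∎
    where
    open ≈-Reasoning
    Q s n : Carrier
    Q = sumList F (map _² xs)
    s = sumList F xs
    n = size xs

  ssd-parallelAxis : ∀ xs c → ssd xs c ≈ Δ₁ xs + moment xs c
  ssd-parallelAxis xs c = begin
    ssd xs c                                                   ≈⟨ ssd-expand xs c ⟩
    Q - (c + c) * s + n * c ²
      ≈⟨ solve 5 (λ Q s n m c → Q :- (c :+ c) :* s :+ n :* (c :* c)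
                             := (Q :- (m :+ m) :* s :+ n :* (m :* m)) :+ n :* ((m :- c) :* (m :- c))
                                :+ (n :* m :- s) :* ((c :+ c) :- (m :+ m))) refl Q s n m c ⟩
    (Q - (m + m) * s + n * m ²) + n * (m - c) ² + (n * m - s) * ((c + c) - (m + m))
      ≈⟨ r≈0⇒x+r*y≈x _ _ (trans (+-congʳ (size*mean≈sum xs)) (-‿inverseʳ s)) ⟩
    (Q - (m + m) * s + n * m ²) + n * (m - c) ²                ≈⟨ +-congʳ (ssd-expand xs m) ⟨
    Δ₁ xs + n * (m - c) ²                                      ∎
    where
    open ≈-Reasoning
    Q s n m : Carrier
    Q = sumList F (map _² xs)
    s = sumList F xs
    n = size xs
    m = mean xs

  D₁-parallelAxis : ∀ xs ys c → D₁ xs ys + moment (xs ++ ys) c ≈ moment xs c + moment ys c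
  D₁-parallelAxis xs ys c = begin
    (Δ₁ (xs ++ ys) - Δ₁ xs - Δ₁ ys) + moment (xs ++ ys) c
      ≈⟨ solve 4 (λ Δxy Δx Δy v → (Δxy :- Δx :- Δy) :+ v := (Δxy :+ v) :- Δx :- Δy) refl _ _ _ _ ⟩
    (Δ₁ (xs ++ ys) + moment (xs ++ ys) c) - Δ₁ xs - Δ₁ ys
      ≈⟨ +-congʳ (+-congʳ (sym (ssd-parallelAxis (xs ++ ys) c))) ⟩
    ssd (xs ++ ys) c - Δ₁ xs - Δ₁ ys
      ≈⟨ +-congʳ (+-congʳ (trans (ssd-++ xs ys c) (+-cong (ssd-parallelAxis xs c) (ssd-parallelAxis ys c)))) ⟩
    (Δ₁ xs + u) + (Δ₁ ys + v) - Δ₁ xs - Δ₁ ys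
      ≈⟨ solve 4 (λ Δx Δy u v → (Δx :+ u) :+ (Δy :+ v) :- Δx :- Δy := u :+ v) refl _ _ u v ⟩
    u + v ∎
    where
    open ≈-Reasoning
    u v : Carrier
    u = moment xs c
    v = moment ys c

  0≤ssd : ∀ xs c → 0# ≤ ssd xs c
  0≤ssd []       c = ≤-refl
  0≤ssd (x ∷ xs) c = +-nonNeg (0≤x² (x - c)) (0≤ssd xs c)

  D₁≤ : ∀ xs ys c → D₁ xs ys ≤ moment xs c + moment ys c
  D₁≤ xs ys c = ≤-respʳ-≈ (D₁-parallelAxis xs ys c)
    (≤-respˡ-≈ (+-identityʳ _) (+-mono-≤ ≤-refl (*-nonneg (0≤fromℕ (length (xs ++ ys))) (0≤x² _))))

  D₁≈ : ∀ xs ys → D₁ xs ys ≈ moment xs (mean (xs ++ ys)) + moment ys (mean (xs ++ ys))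
  D₁≈ xs ys = begin
    D₁ xs ys                                ≈⟨ +-identityʳ _ ⟨
    D₁ xs ys + 0#                           ≈⟨ +-congˡ moment-about-mean≈0 ⟨
    D₁ xs ys + moment (xs ++ ys) m          ≈⟨ D₁-parallelAxis xs ys m ⟩
    moment xs m + moment ys m               ∎
    where
    open ≈-Reasoning
    m : Carrier
    m = mean (xs ++ ys)
    moment-about-mean≈0 : moment (xs ++ ys) m ≈ 0#
    moment-about-mean≈0 = trans (*-congˡ (trans (*-congʳ (-‿inverseʳ m)) (zeroˡ _))) (zeroʳ _)

  moment-++≤ʳ : ∀ xs ys → xs ≢ [] → length xs ≤ℕ length ys → ∀ c →
    moment (xs ++ ys) c ≤ fromℕ F 3 * D₁ xs ys + fromℕ F 3 * moment ys c
  moment-++≤ʳ xs ys xs≢[] |xs|≤|ys| c =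
    ≤-respˡ-≈ (*-congʳ (sym (size-++ xs ys)))
      (≤-respʳ-≈ (+-congʳ (*-congˡ (sym (D₁≈ xs ys))))
        (centre-deviation-bound (0≤fromℕ (length xs)) (size≉0 xs≢[]) (fromℕ-mono-≤ |xs|≤|ys|) (mean-++ xs ys) c))

  moment-++≤ˡ : ∀ xs ys → ys ≢ [] → length ys ≤ℕ length xs → ∀ c →
    moment (xs ++ ys) c ≤ fromℕ F 3 * D₁ xs ys + fromℕ F 3 * moment xs c
  moment-++≤ˡ xs ys ys≢[] |ys|≤|xs| c =
    ≤-respˡ-≈ (*-congʳ (trans (+-comm _ _) (sym (size-++ xs ys))))
      (≤-respʳ-≈ (+-congʳ (*-congˡ (trans (+-comm _ _) (sym (D₁≈ xs ys)))))
        (centre-deviation-bound (0≤fromℕ (length ys)) (size≉0 ys≢[]) (fromℕ-mono-≤ |ys|≤|xs|)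
          (trans (*-congʳ (+-comm _ _)) (trans (mean-++ xs ys) (+-comm _ _))) c))

  D₁-++-++≤ : ∀ ws xs ys zs → ws ≢ [] → zs ≢ [] → length ws ≤ℕ length xs → length zs ≤ℕ length ys →
              D₁ (ws ++ xs) (ys ++ zs) ≤ fromℕ F 3 * (D₁ ws xs + D₁ xs ys + D₁ ys zs)
  D₁-++-++≤ ws xs ys zs ws≢[] zs≢[] |ws|≤|xs| |zs|≤|ys| = begin
    D₁ (ws ++ xs) (ys ++ zs)                     ≤⟨ D₁≤ (ws ++ xs) (ys ++ zs) q ⟩
    moment (ws ++ xs) q + moment (ys ++ zs) q
      ≤⟨ +-mono-≤ (moment-++≤ʳ ws xs ws≢[] |ws|≤|xs| q) (moment-++≤ˡ ys zs zs≢[] |zs|≤|ys| q) ⟩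
    (three * D₁ ws xs + three * moment xs q) + (three * D₁ ys zs + three * moment ys q)
      ≈⟨ solve 5 (λ t a b u v → (t :* a :+ t :* u) :+ (t :* b :+ t :* v) := t :* (a :+ (u :+ v) :+ b))
                 refl three (D₁ ws xs) (D₁ ys zs) (moment xs q) (moment ys q) ⟩
    three * (D₁ ws xs + (moment xs q + moment ys q) + D₁ ys zs) ≈⟨ *-congˡ (+-congʳ (+-congˡ (D₁≈ xs ys))) ⟨
    three * (D₁ ws xs + D₁ xs ys + D₁ ys zs)         ∎
    where
    open ≤-Reasoning
    three q : Carrier
    three = fromℕ F 3
    q = mean (xs ++ ys)

module FiniteSums {ℓ ℓ₁ ℓ₂} (F : OrderedField ℓ ℓ₁ ℓ₂) where
  open OrderedField F
  open IntegerCoefficientSolver F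
  open OrderedFieldProperties F

  sumFin-cong : ∀ n {f g : Fin n → Carrier} → (∀ i → f i ≈ g i) → sumFin F n f ≈ sumFin F n g
  sumFin-cong zero    f≈g = refl
  sumFin-cong (suc n) f≈g = +-cong (f≈g Fin.zero) (sumFin-cong n (f≈g ∘ Fin.suc))

  sumFin-0# : ∀ n → sumFin F n (λ _ → 0#) ≈ 0#
  sumFin-0# zero    = refl
  sumFin-0# (suc n) = trans (+-identityˡ _) (sumFin-0# n)

  sumFin-+ : ∀ n (f g : Fin n → Carrier) → sumFin F n (λ i → f i + g i) ≈ sumFin F n f + sumFin F n g
  sumFin-+ zero    f g = sym (+-identityʳ 0#)
  sumFin-+ (suc n) f g = trans (+-congˡ (sumFin-+ n (f ∘ Fin.suc) (g ∘ Fin.suc)))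
    (solve 4 (λ a b c d → (a :+ b) :+ (c :+ d) := (a :+ c) :+ (b :+ d)) refl _ _ _ _)

  sumFin-- : ∀ n (f g : Fin n → Carrier) → sumFin F n (λ i → f i - g i) ≈ sumFin F n f - sumFin F n g
  sumFin-- zero    f g = sym (-‿inverseʳ 0#)
  sumFin-- (suc n) f g = trans (+-congˡ (sumFin-- n (f ∘ Fin.suc) (g ∘ Fin.suc)))
    (solve 4 (λ a b c d → (a :- b) :+ (c :- d) := (a :+ c) :- (b :+ d)) refl _ _ _ _)

  sumFin-*ˡ : ∀ n k (f : Fin n → Carrier) → sumFin F n (λ i → k * f i) ≈ k * sumFin F n f
  sumFin-*ˡ zero    k f = sym (zeroʳ k)
  sumFin-*ˡ (suc n) k f = trans (+-congˡ (sumFin-*ˡ n k (f ∘ Fin.suc))) (sym (distribˡ k _ _))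

  sumFin-mono-≤ : ∀ n {f g : Fin n → Carrier} → (∀ i → f i ≤ g i) → sumFin F n f ≤ sumFin F n g
  sumFin-mono-≤ zero    f≤g = ≤-refl
  sumFin-mono-≤ (suc n) f≤g = +-mono-≤ (f≤g Fin.zero) (sumFin-mono-≤ n (f≤g ∘ Fin.suc))

  sumFin-nonNeg : ∀ n {f : Fin n → Carrier} → (∀ i → 0# ≤ f i) → 0# ≤ sumFin F n f
  sumFin-nonNeg zero    0≤f = ≤-refl
  sumFin-nonNeg (suc n) 0≤f = +-nonNeg (0≤f Fin.zero) (sumFin-nonNeg n (0≤f ∘ Fin.suc))

module Coordinates {ℓ ℓ₁ ℓ₂} (F : OrderedField ℓ ℓ₁ ℓ₂) (d : ℕ) where
  open OrderedField F
  open IntegerCoefficientSolver F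
  open OrderedFieldProperties F
  open Scatter F
  open FiniteSums F

  coord : Fin d → List (Point F d) → List Carrier
  coord i = map (λ q → q i)

  coord-++ : ∀ i X Y → coord i (X ++ Y) ≡ coord i X ++ coord i Y
  coord-++ i = List.map-++ (λ q → q i)

  coord-≢[] : ∀ {X} i → NonEmpty F X → coord i X ≢ []
  coord-≢[] {_ ∷ _} i _ ()

  coord-length-≤ : ∀ i X Y → length X ≤ℕ length Y → length (coord i X) ≤ℕ length (coord i Y)
  coord-length-≤ i X Y = ≡.subst₂ _≤ℕ_ (≡.sym (List.length-map _ X)) (≡.sym (List.length-map _ Y))

  sum-‖-‖²≈sumFin-ssd : ∀ Q (p : Point F d) →
    sumList F (map (λ q → ‖_‖² F (_-ₚ_ F q p)) Q) ≈ sumFin F d (λ i → ssd (coord i Q) (p i))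
  sum-‖-‖²≈sumFin-ssd []      p = sym (sumFin-0# d)
  sum-‖-‖²≈sumFin-ssd (q ∷ Q) p =
    trans (+-congˡ (sum-‖-‖²≈sumFin-ssd Q p)) (sym (sumFin-+ d _ (λ i → ssd (coord i Q) (p i))))

  μ≡mean : ∀ Q i → μ F Q i ≡ mean (coord i Q)
  μ≡mean Q i = ≡.cong (λ n → fromℕ F n ⁻¹ * sumList F (coord i Q)) (≡.sym (List.length-map _ Q))

  Δ≈sumFin-Δ₁ : ∀ Q → Δ F Q ≈ sumFin F d (λ i → Δ₁ (coord i Q))
  Δ≈sumFin-Δ₁ Q = trans (sum-‖-‖²≈sumFin-ssd Q (μ F Q))
    (sumFin-cong d (λ i → reflexive (≡.cong (ssd (coord i Q)) (μ≡mean Q i))))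

  Dist≈sumFin-D₁ : ∀ X Y → Dist F X Y ≈ sumFin F d (λ i → D₁ (coord i X) (coord i Y))
  Dist≈sumFin-D₁ X Y = begin
    Δ F (X ++ Y) - Δ F X - Δ F Y
      ≈⟨ +-cong (+-cong (Δ≈sumFin-Δ₁ (X ++ Y)) (-‿cong (Δ≈sumFin-Δ₁ X))) (-‿cong (Δ≈sumFin-Δ₁ Y)) ⟩
    sumFin F d (λ i → Δ₁ (coord i (X ++ Y))) - sumFin F d (λ i → Δ₁ (coord i X)) - sumFin F d (λ i → Δ₁ (coord i Y))
      ≈⟨ trans (sumFin-- d (λ i → Δ₁ (coord i (X ++ Y)) - Δ₁ (coord i X)) (λ i → Δ₁ (coord i Y)))
               (+-congʳ (sumFin-- d (λ i → Δ₁ (coord i (X ++ Y))) (λ i → Δ₁ (coord i X)))) ⟨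
    sumFin F d (λ i → Δ₁ (coord i (X ++ Y)) - Δ₁ (coord i X) - Δ₁ (coord i Y))
      ≈⟨ sumFin-cong d (λ i → +-congʳ (+-congʳ (reflexive (≡.cong Δ₁ (coord-++ i X Y))))) ⟩
    sumFin F d (λ i → D₁ (coord i X) (coord i Y)) ∎
    where open ≈-Reasoning

  0≤Δ : ∀ Q → 0# ≤ Δ F Q
  0≤Δ Q = ≤-respʳ-≈ (sym (Δ≈sumFin-Δ₁ Q)) (sumFin-nonNeg d (λ i → 0≤ssd (coord i Q) _))

  Dist-++-++≤ : ∀ A B C D → NonEmpty F A → NonEmpty F D → length A ≤ℕ length B → length D ≤ℕ length C →
                Dist F (A ++ B) (C ++ D) ≤ fromℕ F 3 * (Dist F A B + Dist F B C + Dist F C D)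
  Dist-++-++≤ A B C D A≢[] D≢[] |A|≤|B| |D|≤|C| = begin
    Dist F (A ++ B) (C ++ D)                                      ≈⟨ Dist≈sumFin-D₁ (A ++ B) (C ++ D) ⟩
    sumFin F d (λ i → D₁ (coord i (A ++ B)) (coord i (C ++ D)))
      ≤⟨ sumFin-mono-≤ d (λ i → ≤-respˡ-≈ (reflexive (≡.sym (≡.cong₂ D₁ (coord-++ i A B) (coord-++ i C D))))
                                  (D₁-++-++≤ (coord i A) (coord i B) (coord i C) (coord i D)
                                     (coord-≢[] i A≢[]) (coord-≢[] i D≢[]) (coord-length-≤ i A B |A|≤|B|) (coord-length-≤ i D C |D|≤|C|))) ⟩
    sumFin F d (λ i → three * (D₁ (coord i A) (coord i B) + D₁ (coord i B) (coord i C) + D₁ (coord i C) (coord i D)))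
      ≈⟨ sumFin-*ˡ d three _ ⟩
    three * sumFin F d (λ i → D₁ (coord i A) (coord i B) + D₁ (coord i B) (coord i C) + D₁ (coord i C) (coord i D))
      ≈⟨ *-congˡ (trans (sumFin-+ d _ _) (+-congʳ (sumFin-+ d _ _))) ⟩
    three * (sumFin F d (λ i → D₁ (coord i A) (coord i B)) + sumFin F d (λ i → D₁ (coord i B) (coord i C))
             + sumFin F d (λ i → D₁ (coord i C) (coord i D)))
      ≈⟨ *-congˡ (+-cong (+-cong (Dist≈sumFin-D₁ A B) (Dist≈sumFin-D₁ B C)) (Dist≈sumFin-D₁ C D)) ⟨
    three * (Dist F A B + Dist F B C + Dist F C D) ∎
    where
    open ≤-Reasoning
    three : Carrier
    three = fromℕ F 3


  Dist-++-++≤Δ : ∀ A B C D → NonEmpty F A → NonEmpty F D → length A ≤ℕ length B → length D ≤ℕ length C →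
                 Dist F (A ++ B) (C ++ D)
                 ≤ fromℕ F 3 * Δ F (B ++ C) + fromℕ F 3 * Dist F A B + fromℕ F 3 * Dist F C D - Δ F B - Δ F C
  Dist-++-++≤Δ A B C D A≢[] D≢[] |A|≤|B| |D|≤|C| = ≤-trans (Dist-++-++≤ A B C D A≢[] D≢[] |A|≤|B| |D|≤|C|)
    (≤-by-difference
      (solve 5 (λ b c bc ab cd →
          con (3 , 0) :* bc :+ con (3 , 0) :* ab :+ con (3 , 0) :* cd :- b :- c
          :- con (3 , 0) :* (ab :+ (bc :- b :- c) :+ cd)
       := con (2 , 0) :* (b :+ c))
        refl (Δ F B) (Δ F C) (Δ F (B ++ C)) (Dist F A B) (Dist F C D))
      (*-nonneg (0≤fromℕ 2) (+-nonNeg (0≤Δ B) (0≤Δ C))))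

lemma29 : ∀ {c ℓ₁ ℓ₂} (F : OrderedField c ℓ₁ ℓ₂) (d : ℕ)
          (A B C D : List (Point F d)) →
          IsFinSet F A → IsFinSet F B → IsFinSet F C → IsFinSet F D →
          NonEmpty F A → NonEmpty F B → NonEmpty F C → NonEmpty F D →
          Disjoint F A B → Disjoint F A C → Disjoint F A D →
          Disjoint F B C → Disjoint F B D → Disjoint F C D →
          length A ≤ℕ length B → length D ≤ℕ length C →
          let open OrderedField F in
          (Δ F (A ++ B ++ C ++ D)
             ≤ Δ F A + fromℕ F 3 * Δ F (B ++ C) + Δ F D
               + fromℕ F 4 * Dist F A B + fromℕ F 4 * Dist F C D)
          ×
          (Dist F (A ++ B) (C ++ D)
             ≤ fromℕ F 3 * Δ F (B ++ C) + fromℕ F 3 * Dist F A B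
               + fromℕ F 3 * Dist F C D - Δ F B - Δ F C)
lemma29 F d A B C D _ _ _ _ A≢[] _ _ D≢[] _ _ _ _ _ _ |A|≤|B| |D|≤|C| =
  ≡.subst (λ Q → Δ F Q ≤ bound₁) (List.++-assoc A B (C ++ D)) (≤-by-difference rearrange (x≤y⇒0≤y-x part₂)) ,
  part₂
  where
  open OrderedField F
  open IntegerCoefficientSolver F
  open OrderedFieldProperties F
  open Coordinates F d
  bound₁ bound₂ : Carrier
  bound₁ = Δ F A + fromℕ F 3 * Δ F (B ++ C) + Δ F D + fromℕ F 4 * Dist F A B + fromℕ F 4 * Dist F C D
  bound₂ = fromℕ F 3 * Δ F (B ++ C) + fromℕ F 3 * Dist F A B + fromℕ F 3 * Dist F C D - Δ F B - Δ F C
  part₂ : Dist F (A ++ B) (C ++ D) ≤ bound₂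
  part₂ = Dist-++-++≤Δ A B C D A≢[] D≢[] |A|≤|B| |D|≤|C|
  rearrange : bound₁ - Δ F ((A ++ B) ++ (C ++ D)) ≈ bound₂ - Dist F (A ++ B) (C ++ D)
  rearrange = solve 8 (λ a b c d ab bc cd all →
      a :+ con (3 , 0) :* bc :+ d :+ con (4 , 0) :* (ab :- a :- b) :+ con (4 , 0) :* (cd :- c :- d) :- all
   := con (3 , 0) :* bc :+ con (3 , 0) :* (ab :- a :- b) :+ con (3 , 0) :* (cd :- c :- d) :- b :- c
      :- (all :- ab :- cd))
    refl (Δ F A) (Δ F B) (Δ F C) (Δ F D) (Δ F (A ++ B)) (Δ F (B ++ C)) (Δ F (C ++ D)) (Δ F ((A ++ B) ++ (C ++ D)))
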